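{- Let $G=(V,E)$ be a simple graph. If the graphic matroid of $G$ has a rainbow circuit-free coloring in which each color is used at most twice, then $G$ is $(2,3)$-sparse.
   Context: The graphic matroid of $G$ has ground set $E$ and independent sets the forests; its circuits are the edge sets of cycles. A coloring of $E$ is a partition into nonempty color classes; it is rainbow circuit-free if every cycle contains two edges of the same color. $G$ is $(2,3)$-sparse if $|E[X]|\le 2|X|-3$ for every $X\subseteq V$ with $|X|\ge 2$, where $E[X]$ is the set of edges with both endpoints in $X$. -}

module Defs where

open import Data.Nat using (ℕ; zero; suc; _+_; _*_; _∸_; _≤_)
open import Data.Fin using (Fin; inject₁; fromℕ) renaming (zero to fzero; suc to fsuc)
open import Data.Fin.Subset using (Subset; _∈_; ∣_∣)
open import Data.Product using (_×_; _,_; proj₁; proj₂; Σ; ∃; ∃-syntax)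
open import Data.Sum using (_⊎_)
open import Data.List using (List; length; filter)
open import Data.List using (allFin)
open import Relation.Binary.PropositionalEquality using (_≡_; _≢_)
open import Relation.Nullary using (¬_)
open import Relation.Nullary.Decidable using (_×-dec_)
open import Data.Fin.Subset.Properties using (_∈?_)
open import Function.Definitions using (Injective)

record Graph (n m : ℕ) : Set where
  field
    ends : Fin m → Fin n × Fin n

open Graph public

Joins : ∀ {n m} → Graph n m → Fin m → Fin n → Fin n → Set
Joins G e x y =
  (proj₁ (ends G e) ≡ x × proj₂ (ends G e) ≡ y) ⊎
  (proj₁ (ends G e) ≡ y × proj₂ (ends G e) ≡ x)

IsSimple : ∀ {n m} → Graph n m → Set
IsSimple G =
  (∀ e → proj₁ (ends G e) ≢ proj₂ (ends G e)) ×
  (∀ e f → Joins G f (proj₁ (ends G e)) (proj₂ (ends G e)) → e ≡ f)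

-- Its edge set {e i} is a circuit of the
-- graphic matroid.
record Cycle {n m : ℕ} (G : Graph n m) : Set where
  field
    len       : ℕ
    len≥3     : 3 ≤ len
    vtx       : Fin (suc len) → Fin n
    closed    : vtx (fromℕ len) ≡ vtx fzero
    vtx-inj   : Injective _≡_ _≡_ (λ i → vtx (inject₁ i))
    edge      : Fin len → Fin m
    edge-inj  : Injective _≡_ _≡_ edge
    edge-joins : ∀ i → Joins G (edge i) (vtx (inject₁ i)) (vtx (fsuc i))

open Cycle public

-- A colouring of E is a map c : Fin m → ℕ (colour classes = nonempty fibres).
-- Rainbow circuit-free: every cycle has two distinct edges of the same colour.
RainbowCircuitFree : ∀ {n m} → Graph n m → (Fin m → ℕ) → Set
RainbowCircuitFree G c =
  (C : Cycle G) → ∃[ i ] ∃[ j ] (i ≢ j × c (edge C i) ≡ c (edge C j))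

AtMostTwice : ∀ {m} → (Fin m → ℕ) → Set
AtMostTwice c = ∀ e f g → e ≢ f → e ≢ g → f ≢ g →
  ¬ (c e ≡ c f × c e ≡ c g)

inducedEdgeCount : ∀ {n m} → Graph n m → Subset n → ℕ
inducedEdgeCount G X =
  length (filter (λ e → (proj₁ (ends G e) ∈? X) ×-dec (proj₂ (ends G e) ∈? X)) (allFin _))

Sparse23 : ∀ {n m} → Graph n m → Set
Sparse23 {n} G = (X : Subset n) → 2 ≤ ∣ X ∣ → inducedEdgeCount G X ≤ 2 * ∣ X ∣ ∸ 3

{-# OPTIONS --safe #-}
module Submission where

-- Let X have p ≥ 2 vertices and let E be the set of edges inside X. Keeping one
-- edge of every colour gives a rainbow set T; since a colour is used at most
-- twice, the remaining edges R satisfy |R| ≤ |T|. A rainbow edge set with at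
-- least as many edges as vertices contains a (rainbow) cycle, so |T| < p, and
-- |E| ≤ |T| + |R| ≤ 2p − 3 unless |T| = p − 1 and every colour of T is used
-- twice. In that last case every vertex v owns a colour, meaning that both
-- edges of that colour are incident to v: otherwise picking for each colour an
-- edge avoiding v gives p − 1 rainbow edges on p − 1 vertices. Two vertices
-- owning the same colour would be joined by two parallel edges, so p ≤ |T|,
-- a contradiction.

open import Defs
open import Data.Bool using (true; false)
open import Data.Fin using (Fin; toℕ) renaming (zero to fzero; suc to fsuc)
import Data.Fin.Properties as Fin
open import Data.Fin.Subset using (Subset; ∣_∣) renaming (_∈_ to _∈ₛ_)
open import Data.Fin.Subset.Properties using (_∈?_)
open import Data.List using (List; []; _∷_; length; filter; tabulate; allFin; upTo; deduplicate)
open import Data.List.Membership.Propositional using (_∈_; find; lose)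
open import Data.List.Membership.Propositional.Properties
  using (∈-filter⁺; ∈-filter⁻; ∈-allFin; ∈-upTo⁺; ∈-upTo⁻; ∈-deduplicate⁻; ∈-length)
open import Data.List.Properties using (filter-notAll; length-upTo)
open import Data.List.Relation.Unary.All as All using (_∷_)
open import Data.List.Relation.Unary.AllPairs as AllPairs using (AllPairs; _∷_)
open import Data.List.Relation.Unary.Any using (Any; here; there; any?)
import Data.List.Relation.Unary.Any.Properties as Any
open import Data.List.Relation.Unary.Unique.Propositional using (Unique; _∷_)
import Data.List.Relation.Unary.Unique.Propositional.Properties as Unique
open import Data.List.Relation.Unary.Unique.DecSetoid.Properties using (deduplicate-!)
open import Data.Nat using (ℕ; zero; suc; _+_; _*_; _∸_; _≤_; _<_; _≟_; _≤?_; _<?_; z≤n; s≤s)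
open import Data.Nat.Properties
open import Data.Nat.Tactic.RingSolver using (solve-∀)
open import Data.Product using (_×_; _,_; proj₁; proj₂; Σ; ∃-syntax)
open import Data.Sum using (_⊎_; inj₁; inj₂)
import Data.Vec as Vec
open import Function using (_∘_)
open import Relation.Binary.Construct.On as On using ()
open import Relation.Binary.Definitions using (DecidableEquality; tri<; tri≈; tri>)
open import Relation.Binary.PropositionalEquality
open import Relation.Nullary using (¬_; Dec; yes; no; ¬?; contradiction)
open import Relation.Nullary.Decidable using (_×-dec_; _⊎-dec_; decidable-stable)
open import Relation.Unary using (Decidable)
open import Relation.Unary.Properties using (∁?)

length-filter+length-filter-∁ : ∀ {A : Set} {P : A → Set} (P? : Decidable P) xs →
  length (filter P? xs) + length (filter (∁? P?) xs) ≡ length xs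
length-filter+length-filter-∁ P? [] = refl
length-filter+length-filter-∁ P? (x ∷ xs) with P? x
... | yes _ = cong suc (length-filter+length-filter-∁ P? xs)
... | no _ = trans (+-suc _ _) (cong suc (length-filter+length-filter-∁ P? xs))

length-filter-∈-tabulate : ∀ {n k} (X : Subset k) (f : Fin n → Fin k) b →
  length (filter (_∈? b Vec.∷ X) (tabulate (fsuc ∘ f))) ≡ length (filter (_∈? X) (tabulate f))
length-filter-∈-tabulate {zero} X f b = refl
length-filter-∈-tabulate {suc n} X f b with f fzero ∈? X
... | yes _ = cong suc (length-filter-∈-tabulate X (f ∘ fsuc) b)
... | no _ = length-filter-∈-tabulate X (f ∘ fsuc) b

length-filter-∈-allFin : ∀ {n} (X : Subset n) → length (filter (_∈? X) (allFin n)) ≡ ∣ X ∣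
length-filter-∈-allFin Vec.[] = refl
length-filter-∈-allFin (true Vec.∷ X) =
  cong suc (trans (length-filter-∈-tabulate X (λ i → i) true) (length-filter-∈-allFin X))
length-filter-∈-allFin (false Vec.∷ X) =
  trans (length-filter-∈-tabulate X (λ i → i) false) (length-filter-∈-allFin X)

module _ {A : Set} (_≟ᴬ_ : DecidableEquality A) where

  without : A → List A → List A
  without x = filter (λ y → ¬? (y ≟ᴬ x))

  ∈-without⁺ : ∀ {x y xs} → y ∈ xs → y ≢ x → y ∈ without x xs
  ∈-without⁺ = ∈-filter⁺ (λ y → ¬? (y ≟ᴬ _))

  ∈-without⁻ : ∀ {x y} xs → y ∈ without x xs → y ∈ xs
  ∈-without⁻ xs y∈ = proj₁ (∈-filter⁻ (λ y → ¬? (y ≟ᴬ _)) {xs = xs} y∈)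

  length-without-< : ∀ {x xs} → x ∈ xs → length (without x xs) < length xs
  length-without-< {x} {xs} x∈xs = filter-notAll (λ y → ¬? (y ≟ᴬ x)) xs (lose x∈xs λ x≢x → x≢x refl)

  2≤length-of-≢ : ∀ {x y xs} → x ∈ xs → y ∈ xs → x ≢ y → 2 ≤ length xs
  2≤length-of-≢ x∈xs y∈xs x≢y =
    ≤-trans (s≤s (∈-length (∈-without⁺ y∈xs (x≢y ∘ sym)))) (length-without-< x∈xs)

  ∃-≢-of-Unique : ∀ {xs} → Unique xs → 2 ≤ length xs → ∀ z → ∃[ x ] x ∈ xs × x ≢ z
  ∃-≢-of-Unique {_ ∷ []} _ (s≤s ()) _
  ∃-≢-of-Unique {x ∷ y ∷ _} ((x≢y ∷ _) ∷ _) _ z with x ≟ᴬ z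
  ... | no x≢z = x , here refl , x≢z
  ... | yes refl = y , there (here refl) , x≢y ∘ sym

  length-≤-of-injective-relation : ∀ {B : Set} (R : B → A → Set) (xs : List B) ys →
    Unique xs → (∀ {x} → x ∈ xs → Any (R x) ys) →
    (∀ {x x′ y} → x ∈ xs → x′ ∈ xs → y ∈ ys → R x y → R x′ y → x ≡ x′) →
    length xs ≤ length ys
  length-≤-of-injective-relation R [] ys _ _ _ = z≤n
  length-≤-of-injective-relation R (x ∷ xs) ys (x∉xs ∷ xs!) total injective
    with find (total (here refl))
  ... | y , y∈ys , Rxy =
    ≤-trans (s≤s (length-≤-of-injective-relation R xs (without y ys) xs! total′ injective′))
            (length-without-< y∈ys)
    where
      total′ : ∀ {x′} → x′ ∈ xs → Any (R x′) (without y ys)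
      total′ x′∈xs with find (total (there x′∈xs))
      ... | y′ , y′∈ys , Rx′y′ = lose (∈-without⁺ y′∈ys y′≢y) Rx′y′
        where
          y′≢y : y′ ≢ y
          y′≢y refl = All.lookup x∉xs x′∈xs (injective (here refl) (there x′∈xs) y∈ys Rxy Rx′y′)
      injective′ : ∀ {x₁ x₂ y′} → x₁ ∈ xs → x₂ ∈ xs → y′ ∈ without y ys → R x₁ y′ → R x₂ y′ → x₁ ≡ x₂
      injective′ x₁∈xs x₂∈xs y′∈ = injective (there x₁∈xs) (there x₂∈xs) (∈-without⁻ ys y′∈)

sparsity-arithmetic : ∀ {p a b} → b ≤ a → a < p → (suc a ≡ p → b < a) → a + b ≤ 2 * p ∸ 3
sparsity-arithmetic {p} {a} {b} b≤a a<p tight = m+n≤o⇒m≤o∸n (a + b) (bound (m≤n⇒m<n∨m≡n a<p))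
  where
    open ≤-Reasoning
    shift : ∀ x y → x + y + 3 ≡ x + suc y + 2
    shift = solve-∀
    double : ∀ x → x + x + 2 ≡ 2 * suc x
    double = solve-∀
    bound : suc (suc a) ≤ p ⊎ suc a ≡ p → a + b + 3 ≤ 2 * p
    bound (inj₁ 2+a≤p) = begin
      a + b + 3         ≤⟨ +-monoˡ-≤ 3 (+-monoʳ-≤ a b≤a) ⟩
      a + a + 3         ≡⟨ shift a a ⟩
      a + suc a + 2     ≤⟨ +-monoˡ-≤ 2 (+-monoˡ-≤ (suc a) (n≤1+n a)) ⟩
      suc a + suc a + 2 ≡⟨ double (suc a) ⟩
      2 * suc (suc a)   ≤⟨ *-monoʳ-≤ 2 2+a≤p ⟩
      2 * p             ∎
    bound (inj₂ refl) = begin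
      a + b + 3         ≡⟨ shift a b ⟩
      a + suc b + 2     ≤⟨ +-monoˡ-≤ 2 (+-monoʳ-≤ a (tight refl)) ⟩
      a + a + 2         ≡⟨ double a ⟩
      2 * suc a         ∎

-- Cycles in edge sets

cons : ∀ {A : Set} → A → (ℕ → A) → ℕ → A
cons a f zero = a
cons a f (suc i) = f i

module _ {n m} (G : Graph n m) where

  Incident : Fin m → Fin n → Set
  Incident e v = proj₁ (ends G e) ≡ v ⊎ proj₂ (ends G e) ≡ v

  incident? : ∀ e v → Dec (Incident e v)
  incident? e v = (proj₁ (ends G e) Fin.≟ v) ⊎-dec (proj₂ (ends G e) Fin.≟ v)

  degree : List (Fin m) → Fin n → ℕ
  degree F v = length (filter (λ e → incident? e v) F)

  EndsIn : List (Fin n) → Fin m → Set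
  EndsIn Y e = proj₁ (ends G e) ∈ Y × proj₂ (ends G e) ∈ Y

  CycleIn : List (Fin m) → Set
  CycleIn F = Σ (Cycle G) λ C → ∀ i → edge C i ∈ F

  CycleIn-mono : ∀ {F F′} → (∀ {e} → e ∈ F → e ∈ F′) → CycleIn F → CycleIn F′
  CycleIn-mono F⊆F′ (C , C⊆F) = C , F⊆F′ ∘ C⊆F

  Joins-sym : ∀ {e x y} → Joins G e x y → Joins G e y x
  Joins-sym (inj₁ (p , q)) = inj₂ (p , q)
  Joins-sym (inj₂ (p , q)) = inj₁ (p , q)

  Joins-ends : ∀ {e x y x′ y′} → Joins G e x y → Joins G e x′ y′ →
               (x ≡ x′ × y ≡ y′) ⊎ (x ≡ y′ × y ≡ x′)
  Joins-ends (inj₁ (p , q)) (inj₁ (p′ , q′)) = inj₁ (trans (sym p) p′ , trans (sym q) q′)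
  Joins-ends (inj₁ (p , q)) (inj₂ (p′ , q′)) = inj₂ (trans (sym p) p′ , trans (sym q) q′)
  Joins-ends (inj₂ (p , q)) (inj₁ (p′ , q′)) = inj₂ (trans (sym q) q′ , trans (sym p) p′)
  Joins-ends (inj₂ (p , q)) (inj₂ (p′ , q′)) = inj₁ (trans (sym q) q′ , trans (sym p) p′)

  Incident⇒Joins : ∀ {e x y} → Incident e x → Incident e y → x ≢ y → Joins G e x y
  Incident⇒Joins (inj₁ p) (inj₁ q) x≢y = contradiction (trans (sym p) q) x≢y
  Incident⇒Joins (inj₁ p) (inj₂ q) x≢y = inj₁ (p , q)
  Incident⇒Joins (inj₂ p) (inj₁ q) x≢y = inj₂ (q , p)
  Incident⇒Joins (inj₂ p) (inj₂ q) x≢y = contradiction (trans (sym p) q) x≢y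

  Incident⇒∃Joins : ∀ {Y e v} → EndsIn Y e → Incident e v → ∃[ x ] x ∈ Y × Joins G e x v
  Incident⇒∃Joins (_ , y∈Y) (inj₁ p) = _ , y∈Y , inj₂ (p , refl)
  Incident⇒∃Joins (x∈Y , _) (inj₂ q) = _ , x∈Y , inj₁ (refl , q)

  record ClosedWalk : Set where
    field
      size         : ℕ
      size≥3       : 3 ≤ size
      vertexAt     : ℕ → Fin n
      edgeAt       : ℕ → Fin m
      closes       : vertexAt size ≡ vertexAt 0
      vertexAt-inj : ∀ i j → i < size → j < size → vertexAt i ≡ vertexAt j → i ≡ j
      edgeAt-joins : ∀ i → i < size → Joins G (edgeAt i) (vertexAt i) (vertexAt (suc i))

  module _ (W : ClosedWalk) where
    open ClosedWalk W

    private
      -- An edge used twice must be used back and forth by consecutive steps,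
      -- which the distinctness of the vertices only allows when size = 2.
      edgeAt-≢ : ∀ i j → i < j → j < size → edgeAt i ≢ edgeAt j
      edgeAt-≢ i j i<j j<size eq
        with Joins-ends (edgeAt-joins i (<-trans i<j j<size))
                        (subst (λ e → Joins G e _ _) (sym eq) (edgeAt-joins j j<size))
      ... | inj₁ (vi≡vj , _) = <⇒≢ i<j (vertexAt-inj i j (<-trans i<j j<size) j<size vi≡vj)
      ... | inj₂ (vi≡v1+j , v1+i≡vj)
        with vertexAt-inj (suc i) j (≤-<-trans i<j j<size) j<size v1+i≡vj | m≤n⇒m<n∨m≡n j<size
      ...   | refl | inj₁ 2+i<size =
        m≢1+n+m i (vertexAt-inj i (suc j) (<-trans i<j j<size) 2+i<size vi≡v1+j)
      ...   | refl | inj₂ refl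
        with vertexAt-inj i 0 (<-trans i<j j<size) (≤-trans (s≤s z≤n) size≥3) (trans vi≡v1+j closes)
      ...     | refl = contradiction size≥3 λ { (s≤s (s≤s ())) }

      edgeAt-inj : ∀ i j → i < size → j < size → edgeAt i ≡ edgeAt j → i ≡ j
      edgeAt-inj i j i<size j<size eq with <-cmp i j
      ... | tri< i<j _ _ = contradiction eq (edgeAt-≢ i j i<j j<size)
      ... | tri≈ _ i≡j _ = i≡j
      ... | tri> _ _ j<i = contradiction (sym eq) (edgeAt-≢ j i j<i i<size)

    ClosedWalk⇒CycleIn : ∀ {F} → (∀ i → i < size → edgeAt i ∈ F) → CycleIn F
    ClosedWalk⇒CycleIn edgeAt∈F = C , λ i → edgeAt∈F (toℕ i) (Fin.toℕ<n i)
      where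
        C : Cycle G
        C = record
          { len = size
          ; len≥3 = size≥3
          ; vtx = λ i → vertexAt (toℕ i)
          ; closed = trans (cong vertexAt (Fin.toℕ-fromℕ size)) closes
          ; vtx-inj = λ {i} {j} eq → Fin.toℕ-injective
              (vertexAt-inj (toℕ i) (toℕ j) (Fin.toℕ<n i) (Fin.toℕ<n j)
                 (subst₂ (λ i′ j′ → vertexAt i′ ≡ vertexAt j′) (Fin.toℕ-inject₁ i) (Fin.toℕ-inject₁ j) eq))
          ; edge = λ i → edgeAt (toℕ i)
          ; edge-inj = λ {i} {j} eq → Fin.toℕ-injective
              (edgeAt-inj (toℕ i) (toℕ j) (Fin.toℕ<n i) (Fin.toℕ<n j) eq)
          ; edge-joins = λ i → subst (λ i′ → Joins G (edgeAt (toℕ i)) (vertexAt i′) (vertexAt (suc (toℕ i))))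
                                  (sym (Fin.toℕ-inject₁ i)) (edgeAt-joins (toℕ i) (Fin.toℕ<n i))
          }

  module _ (simple : IsSimple G) where

    Joins-irrefl : ∀ {e x} → ¬ Joins G e x x
    Joins-irrefl {e} (inj₁ (p , q)) = proj₁ simple e (trans p (sym q))
    Joins-irrefl {e} (inj₂ (p , q)) = proj₁ simple e (trans p (sym q))

    Joins-parallel : ∀ {e f x y} → Joins G e x y → Joins G f x y → e ≡ f
    Joins-parallel {e} {f} (inj₁ (p , q)) J = proj₂ simple e f (subst₂ (Joins G f) (sym p) (sym q) J)
    Joins-parallel {e} {f} (inj₂ (p , q)) J =
      proj₂ simple e f (subst₂ (Joins G f) (sym p) (sym q) (Joins-sym J))

    module MinDegree≥2 (Y : List (Fin n)) (F : List (Fin m)) (F! : Unique F)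
                       (F⊆Y : ∀ {f} → f ∈ F → EndsIn Y f)
                       (degree≥2 : ∀ {y} → y ∈ Y → 2 ≤ degree F y) where

      record Path : Set where
        field
          size         : ℕ
          vertexAt     : ℕ → Fin n
          edgeAt       : ℕ → Fin m
          vertexAt-inj : ∀ i j → i ≤ size → j ≤ size → vertexAt i ≡ vertexAt j → i ≡ j
          vertexAt∈Y   : ∀ i → i ≤ size → vertexAt i ∈ Y
          edgeAt-joins : ∀ i → i < size → Joins G (edgeAt i) (vertexAt i) (vertexAt (suc i))
          edgeAt∈F     : ∀ i → i < size → edgeAt i ∈ F

      Path-size< : (P : Path) → Path.size P < length Y
      Path-size< P = subst (_≤ length Y) (length-upTo (suc size))
        (length-≤-of-injective-relation Fin._≟_ (λ i y → vertexAt i ≡ y) (upTo (suc size)) Y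
          (Unique.upTo⁺ (suc size))
          (λ i∈ → lose (vertexAt∈Y _ (≤-pred (∈-upTo⁻ i∈))) refl)
          (λ i∈ j∈ _ vi≡y vj≡y →
            vertexAt-inj _ _ (≤-pred (∈-upTo⁻ i∈)) (≤-pred (∈-upTo⁻ j∈)) (trans vi≡y (sym vj≡y))))
        where open Path P

      -- edgeAt 0 of this empty path is only the edge that the first step avoids.
      trivial : ∀ {f} → f ∈ F → Path
      trivial {f} f∈F = record
        { size = 0
        ; vertexAt = λ _ → proj₁ (ends G f)
        ; edgeAt = λ _ → f
        ; vertexAt-inj = λ { _ _ z≤n z≤n _ → refl }
        ; vertexAt∈Y = λ _ _ → proj₁ (F⊆Y f∈F)
        ; edgeAt-joins = λ _ ()
        ; edgeAt∈F = λ _ ()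
        }

      module _ (P : Path) {f x} (f∈F : f ∈ F) (J : Joins G f x (Path.vertexAt P 0)) where
        open Path P

        prepend : x ∈ Y → (∀ j → j ≤ size → vertexAt j ≢ x) → Path
        prepend x∈Y fresh = record
          { size = suc size
          ; vertexAt = cons x vertexAt
          ; edgeAt = cons f edgeAt
          ; vertexAt-inj = inj
          ; vertexAt∈Y = λ { zero _ → x∈Y ; (suc i) (s≤s i≤size) → vertexAt∈Y i i≤size }
          ; edgeAt-joins = λ { zero _ → J ; (suc i) (s≤s i<size) → edgeAt-joins i i<size }
          ; edgeAt∈F = λ { zero _ → f∈F ; (suc i) (s≤s i<size) → edgeAt∈F i i<size }
          }
          where
            inj : ∀ i j → i ≤ suc size → j ≤ suc size → cons x vertexAt i ≡ cons x vertexAt j → i ≡ j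
            inj zero zero _ _ _ = refl
            inj zero (suc j) _ (s≤s j≤size) eq = contradiction (sym eq) (fresh j j≤size)
            inj (suc i) zero (s≤s i≤size) _ eq = contradiction eq (fresh i i≤size)
            inj (suc i) (suc j) (s≤s i≤size) (s≤s j≤size) eq = cong suc (vertexAt-inj i j i≤size j≤size eq)

        close : f ≢ edgeAt 0 → ∀ {j} → j ≤ size → vertexAt j ≡ x → CycleIn F
        close f≢e₀ {j} j≤size vj≡x = ClosedWalk⇒CycleIn W edgeAt∈F′
          where
            size≥3 : ∀ j → j ≤ size → vertexAt j ≡ x → 3 ≤ suc j
            size≥3 zero _ refl = contradiction J Joins-irrefl
            size≥3 (suc zero) 1≤size refl =
              contradiction (sym (Joins-parallel (edgeAt-joins 0 1≤size) (Joins-sym J))) f≢e₀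
            size≥3 (suc (suc _)) _ _ = s≤s (s≤s (s≤s z≤n))
            j<⇒≤size : ∀ {i} → i < j → i ≤ size
            j<⇒≤size i<j = ≤-trans (<⇒≤ i<j) j≤size
            inj : ∀ i k → i < suc j → k < suc j → cons x vertexAt i ≡ cons x vertexAt k → i ≡ k
            inj zero zero _ _ _ = refl
            inj zero (suc k) _ (s≤s k<j) eq =
              contradiction (vertexAt-inj j k j≤size (j<⇒≤size k<j) (trans vj≡x eq)) (>⇒≢ k<j)
            inj (suc i) zero (s≤s i<j) _ eq =
              contradiction (vertexAt-inj j i j≤size (j<⇒≤size i<j) (trans vj≡x (sym eq))) (>⇒≢ i<j)
            inj (suc i) (suc k) (s≤s i<j) (s≤s k<j) eq =
              cong suc (vertexAt-inj i k (j<⇒≤size i<j) (j<⇒≤size k<j) eq)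
            W : ClosedWalk
            W = record
              { size = suc j
              ; size≥3 = size≥3 j j≤size vj≡x
              ; vertexAt = cons x vertexAt
              ; edgeAt = cons f edgeAt
              ; closes = vj≡x
              ; vertexAt-inj = inj
              ; edgeAt-joins = λ { zero _ → J ; (suc i) (s≤s i<j) → edgeAt-joins i (≤-trans i<j j≤size) }
              }
            edgeAt∈F′ : ∀ i → i < suc j → cons f edgeAt i ∈ F
            edgeAt∈F′ zero _ = f∈F
            edgeAt∈F′ (suc i) (s≤s i<j) = edgeAt∈F i (≤-trans i<j j≤size)

      other-edge : ∀ {v} → v ∈ Y → (e : Fin m) → ∃[ f ] f ∈ F × Incident f v × f ≢ e
      other-edge {v} v∈Y e
        with ∃-≢-of-Unique Fin._≟_ (Unique.filter⁺ (λ f → incident? f v) F!) (degree≥2 v∈Y) e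
      ... | f , f∈ , f≢e with ∈-filter⁻ (λ f → incident? f v) {xs = F} f∈
      ... | f∈F , f∋v = f , f∈F , f∋v , f≢e

      step : (P : Path) → CycleIn F ⊎ Σ Path λ P′ → Path.size P′ ≡ suc (Path.size P)
      step P with other-edge (Path.vertexAt∈Y P 0 z≤n) (Path.edgeAt P 0)
      ... | f , f∈F , f∋v₀ , f≢e₀ with Incident⇒∃Joins (F⊆Y f∈F) f∋v₀
      ... | x , x∈Y , J with any? (λ j → Path.vertexAt P j Fin.≟ x) (upTo (suc (Path.size P)))
      ... | yes visited = let j , j∈ , vj≡x = find visited in
                          inj₁ (close P f∈F J f≢e₀ (≤-pred (∈-upTo⁻ j∈)) vj≡x)
      ... | no fresh =
        inj₂ (prepend P f∈F J x∈Y (λ j j≤size vj≡x → fresh (lose (∈-upTo⁺ (s≤s j≤size)) vj≡x)) , refl)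

      walk : ∀ N (P : Path) → length Y ≤ Path.size P + N → CycleIn F
      walk zero P h = contradiction (subst (length Y ≤_) (+-identityʳ _) h) (<⇒≱ (Path-size< P))
      walk (suc N) P h with step P
      ... | inj₁ cycle = cycle
      ... | inj₂ (P′ , refl) = walk N P′ (subst (length Y ≤_) (+-suc _ N) h)

    -- Remove a vertex of degree at most one together with its edge; when there
    -- is none, a walk that never turns back must close up.
    dense⇒CycleIn : ∀ (Y : List (Fin n)) F → Unique F → (∀ {f} → f ∈ F → EndsIn Y f) →
                    1 ≤ length F → length Y ≤ length F → CycleIn F
    dense⇒CycleIn Y F = go (length Y) Y F ≤-refl
      where
        go : ∀ N Y F → length Y ≤ N → Unique F → (∀ {f} → f ∈ F → EndsIn Y f) →
             1 ≤ length F → length Y ≤ length F → CycleIn F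
        go N Y [] _ _ _ () _
        go N Y F@(f₀ ∷ _) Y≤N F! F⊆Y _ Y≤F with any? (λ y → degree F y ≤? 1) Y
        ... | no ¬leaf = walk (length Y) (trivial (here refl)) ≤-refl
          where
            degree≥2 : ∀ {y} → y ∈ Y → 2 ≤ degree F y
            degree≥2 y∈Y = ≰⇒> λ deg≤1 → ¬leaf (lose y∈Y deg≤1)
            open MinDegree≥2 Y F F! F⊆Y degree≥2 using (walk; trivial)
        ... | yes leaf with find leaf | N
        ...   | y , y∈Y , _ | zero = contradiction (≤-trans (∈-length y∈Y) Y≤N) λ ()
        ...   | y , y∈Y , deg≤1 | suc N =
          CycleIn-mono (λ f∈F′ → proj₁ (∈-filter⁻ avoids? {xs = F} f∈F′))
            (go N Y′ F′ (≤-pred (≤-trans Y′<Y Y≤N)) (Unique.filter⁺ avoids? F!) F′⊆Y′ 1≤F′ Y′≤F′)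
          where
            avoids? = ∁? (λ f → incident? f y)
            Y′ = without Fin._≟_ y Y
            F′ = filter avoids? F
            Y′<Y : length Y′ < length Y
            Y′<Y = length-without-< Fin._≟_ y∈Y
            F≤1+F′ : length F ≤ suc (length F′)
            F≤1+F′ = subst (_≤ suc (length F′)) (length-filter+length-filter-∁ (λ f → incident? f y) F)
                       (+-monoˡ-≤ (length F′) deg≤1)
            2≤Y : 2 ≤ length Y
            2≤Y = 2≤length-of-≢ Fin._≟_ (proj₁ (F⊆Y (here refl))) (proj₂ (F⊆Y (here refl))) (proj₁ simple f₀)
            1≤F′ : 1 ≤ length F′
            1≤F′ = ≤-pred (≤-trans 2≤Y (≤-trans Y≤F F≤1+F′))
            Y′≤F′ : length Y′ ≤ length F′
            Y′≤F′ = ≤-pred (≤-trans Y′<Y (≤-trans Y≤F F≤1+F′))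
            F′⊆Y′ : ∀ {f} → f ∈ F′ → EndsIn Y′ f
            F′⊆Y′ f∈F′ with ∈-filter⁻ avoids? {xs = F} f∈F′
            ... | f∈F , f∌y = ∈-without⁺ Fin._≟_ (proj₁ (F⊆Y f∈F)) (f∌y ∘ inj₁)
                            , ∈-without⁺ Fin._≟_ (proj₂ (F⊆Y f∈F)) (f∌y ∘ inj₂)

-- Colourings

module _ {m} (c : Fin m → ℕ) where

  Rainbow : List (Fin m) → Set
  Rainbow = AllPairs (λ e f → c e ≢ c f)

  Rainbow⇒Unique : ∀ {F} → Rainbow F → Unique F
  Rainbow⇒Unique = AllPairs.map (λ ce≢cf e≡f → ce≢cf (cong c e≡f))

  Rainbow-injective : ∀ {F e f} → Rainbow F → e ∈ F → f ∈ F → c e ≡ c f → e ≡ f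
  Rainbow-injective (_ ∷ _) (here refl) (here refl) _ = refl
  Rainbow-injective (e≁ ∷ _) (here refl) (there f∈F) ce≡cf = contradiction ce≡cf (All.lookup e≁ f∈F)
  Rainbow-injective (f≁ ∷ _) (there e∈F) (here refl) ce≡cf = contradiction (sym ce≡cf) (All.lookup f≁ e∈F)
  Rainbow-injective (_ ∷ F!) (there e∈F) (there f∈F) = Rainbow-injective F! e∈F f∈F

  representatives : List (Fin m) → List (Fin m)
  representatives = deduplicate (λ e f → c e ≟ c f)

  representatives-Rainbow : ∀ F → Rainbow (representatives F)
  representatives-Rainbow = deduplicate-! (On.decSetoid ≡-decSetoid c)

  ∈-representatives⁻ : ∀ F {e} → e ∈ representatives F → e ∈ F
  ∈-representatives⁻ = ∈-deduplicate⁻ (λ e f → c e ≟ c f)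

  ∃-representative : ∀ {F e} → e ∈ F → Any (λ t → c e ≡ c t) (representatives F)
  ∃-representative e∈F =
    Any.deduplicate⁺ (λ e f → c e ≟ c f) (λ cy≡cx ce≡cx → trans ce≡cx (sym cy≡cx)) (lose e∈F refl)

  AtMostTwice⇒≡ : AtMostTwice c → ∀ {e f g} → e ≢ g → f ≢ g → c e ≡ c g → c f ≡ c g → e ≡ f
  AtMostTwice⇒≡ twice {e} {f} {g} e≢g f≢g ce≡cg cf≡cg with e Fin.≟ f
  ... | yes e≡f = e≡f
  ... | no e≢f = contradiction (trans ce≡cg (sym cf≡cg) , ce≡cg) (twice e f g e≢f e≢g f≢g)

RainbowCircuitFree⇒¬CycleIn : ∀ {n m} {G : Graph n m} {c : Fin m → ℕ} → RainbowCircuitFree G c →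
                              ∀ {F} → Rainbow c F → ¬ CycleIn G F
RainbowCircuitFree⇒¬CycleIn rcf F-rainbow (C , C⊆F) with rcf C
... | i , j , i≢j , ci≡cj = i≢j (edge-inj C (Rainbow-injective _ F-rainbow (C⊆F i) (C⊆F j) ci≡cj))

-- Counting the edges inside a vertex set

module Sparsity {n m} (G : Graph n m) (simple : IsSimple G) (c : Fin m → ℕ)
                (rcf : RainbowCircuitFree G c) (twice : AtMostTwice c) (X : Subset n) where

  inside? : ∀ e → Dec (proj₁ (ends G e) ∈ₛ X × proj₂ (ends G e) ∈ₛ X)
  inside? e = (proj₁ (ends G e) ∈? X) ×-dec (proj₂ (ends G e) ∈? X)

  E : List (Fin m)
  E = filter inside? (allFin m)

  V : List (Fin n)
  V = filter (_∈? X) (allFin n)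

  E! : Unique E
  E! = Unique.filter⁺ _ (Unique.allFin⁺ m)

  E⊆V : ∀ {e} → e ∈ E → EndsIn G V e
  E⊆V e∈E with ∈-filter⁻ inside? {xs = allFin m} e∈E
  ... | _ , x∈X , y∈X = ∈-filter⁺ (_∈? X) (∈-allFin _) x∈X , ∈-filter⁺ (_∈? X) (∈-allFin _) y∈X

  T : List (Fin m)
  T = representatives c E

  T⊆E : ∀ {t} → t ∈ T → t ∈ E
  T⊆E = ∈-representatives⁻ c E

  T-rainbow : Rainbow c T
  T-rainbow = representatives-Rainbow c E

  _∈T? : ∀ e → Dec (e ∈ T)
  e ∈T? = any? (e Fin.≟_) T

  R : List (Fin m)
  R = filter (∁? _∈T?) E

  R⊆E : ∀ {r} → r ∈ R → r ∈ E
  R⊆E r∈R = proj₁ (∈-filter⁻ (∁? _∈T?) {xs = E} r∈R)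

  R∌T : ∀ {r t} → r ∈ R → t ∈ T → r ≢ t
  R∌T r∈R t∈T refl = proj₂ (∈-filter⁻ (∁? _∈T?) {xs = E} r∈R) t∈T

  E≤T+R : length E ≤ length T + length R
  E≤T+R = begin
    length E                                ≡⟨ sym (length-filter+length-filter-∁ _∈T? E) ⟩
    length (filter _∈T? E) + length R       ≤⟨ +-monoˡ-≤ (length R) E∩T≤T ⟩
    length T + length R                     ∎
    where
      open ≤-Reasoning
      E∩T≤T : length (filter _∈T? E) ≤ length T
      E∩T≤T = length-≤-of-injective-relation Fin._≟_ _≡_ _ T (Unique.filter⁺ _ E!)
        (λ e∈ → proj₂ (∈-filter⁻ _∈T? {xs = E} e∈))
        (λ _ _ _ e≡t e′≡t → trans e≡t (sym e′≡t))

  R-colours-injective : ∀ {r r′ t} → r ∈ R → r′ ∈ R → t ∈ T → c r ≡ c t → c r′ ≡ c t → r ≡ r′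
  R-colours-injective r∈R r′∈R t∈T = AtMostTwice⇒≡ c twice (R∌T r∈R t∈T) (R∌T r′∈R t∈T)

  R≤T : length R ≤ length T
  R≤T = length-≤-of-injective-relation Fin._≟_ (λ r t → c r ≡ c t) R T (Unique.filter⁺ _ E!)
    (∃-representative c ∘ R⊆E) R-colours-injective

  T<V : 2 ≤ length V → length T < length V
  T<V 2≤V = ≰⇒> λ V≤T → RainbowCircuitFree⇒¬CycleIn rcf T-rainbow
    (dense⇒CycleIn G simple V T (Rainbow⇒Unique c T-rainbow) (E⊆V ∘ T⊆E)
      (≤-trans (s≤s z≤n) (≤-trans 2≤V V≤T)) V≤T)

  HasPartner : Fin m → Set
  HasPartner t = Any (λ r → r ≢ t × c r ≡ c t) E

  hasPartner? : ∀ t → Dec (HasPartner t)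
  hasPartner? t = any? (λ r → ¬? (r Fin.≟ t) ×-dec (c r ≟ c t)) E

  ¬HasPartner⇒R<T : ∀ {t} → t ∈ T → ¬ HasPartner t → length R < length T
  ¬HasPartner⇒R<T {t} t∈T lonely = ≤-<-trans R≤T∖t (length-without-< Fin._≟_ t∈T)
    where
      other-representative : ∀ {r} → r ∈ R → Any (λ t′ → c r ≡ c t′) (without Fin._≟_ t T)
      other-representative r∈R with find (∃-representative c (R⊆E r∈R))
      ... | t′ , t′∈T , cr≡ct′ = lose (∈-without⁺ Fin._≟_ t′∈T t′≢t) cr≡ct′
        where
          t′≢t : t′ ≢ t
          t′≢t refl = lonely (lose (R⊆E r∈R) (R∌T r∈R t∈T , cr≡ct′))
      R≤T∖t : length R ≤ length (without Fin._≟_ t T)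
      R≤T∖t = length-≤-of-injective-relation Fin._≟_ (λ r t′ → c r ≡ c t′) R _ (Unique.filter⁺ _ E!)
        other-representative
        (λ r∈R r′∈R t′∈ → R-colours-injective r∈R r′∈R (∈-without⁻ Fin._≟_ T t′∈))

  Avoids : Fin n → Fin m → Fin m → Set
  Avoids v t e = c e ≡ c t × ¬ Incident G e v

  avoids? : ∀ v t e → Dec (Avoids v t e)
  avoids? v t e = (c e ≟ c t) ×-dec ¬? (incident? G e v)

  Owns : Fin n → Fin m → Set
  Owns v t = ¬ Any (Avoids v t) E

  owns? : ∀ v t → Dec (Owns v t)
  owns? v t = ¬? (any? (avoids? v t) E)

  Owns⇒Incident : ∀ {v t e} → Owns v t → e ∈ E → c e ≡ c t → Incident G e v
  Owns⇒Incident {v} {e = e} owns e∈E ce≡ct =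
    decidable-stable (incident? G e v) (λ e∌v → owns (lose e∈E (ce≡ct , e∌v)))

  ∃-owned : 2 ≤ length V → suc (length T) ≡ length V → ∀ {v} → v ∈ V → Any (Owns v) T
  ∃-owned 2≤V tight {v} v∈V = decidable-stable (any? (owns? v) T) λ none →
    RainbowCircuitFree⇒¬CycleIn rcf Tᵥ-rainbow
      (dense⇒CycleIn G simple (without Fin._≟_ v V) Tᵥ (Rainbow⇒Unique c Tᵥ-rainbow)
        Tᵥ⊆V∖v (≤-trans 1≤T (T≤Tᵥ none)) (≤-trans V∖v≤T (T≤Tᵥ none)))
    where
      misses-v? = λ e → ¬? (incident? G e v)
      Eᵥ = filter misses-v? E
      Tᵥ = representatives c Eᵥ
      Tᵥ-rainbow = representatives-Rainbow c Eᵥ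
      Tᵥ⊆V∖v : ∀ {e} → e ∈ Tᵥ → EndsIn G (without Fin._≟_ v V) e
      Tᵥ⊆V∖v e∈Tᵥ with ∈-filter⁻ misses-v? {xs = E} (∈-representatives⁻ c Eᵥ e∈Tᵥ)
      ... | e∈E , e∌v = ∈-without⁺ Fin._≟_ (proj₁ (E⊆V e∈E)) (e∌v ∘ inj₁)
                      , ∈-without⁺ Fin._≟_ (proj₂ (E⊆V e∈E)) (e∌v ∘ inj₂)
      T≤Tᵥ : ¬ Any (Owns v) T → length T ≤ length Tᵥ
      T≤Tᵥ none = length-≤-of-injective-relation Fin._≟_ (λ t t′ → c t ≡ c t′) T Tᵥ
        (Rainbow⇒Unique c T-rainbow) colour-avoids-v
        (λ t∈T t′∈T _ ct≡ct″ ct′≡ct″ → Rainbow-injective c T-rainbow t∈T t′∈T (trans ct≡ct″ (sym ct′≡ct″)))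
        where
          colour-avoids-v : ∀ {t} → t ∈ T → Any (λ t′ → c t ≡ c t′) Tᵥ
          colour-avoids-v {t} t∈T
            with find (decidable-stable (any? (avoids? v t) E) (none ∘ lose t∈T))
          ... | e , e∈E , ce≡ct , e∌v
            with find (∃-representative c (∈-filter⁺ misses-v? e∈E e∌v))
          ... | t′ , t′∈Tᵥ , ce≡ct′ = lose t′∈Tᵥ (trans (sym ce≡ct) ce≡ct′)
      1≤T : 1 ≤ length T
      1≤T = ≤-pred (subst (2 ≤_) (sym tight) 2≤V)
      V∖v≤T : length (without Fin._≟_ v V) ≤ length T
      V∖v≤T = ≤-pred (subst (suc (length (without Fin._≟_ v V)) ≤_) (sym tight)
                             (length-without-< Fin._≟_ v∈V))

  owner-unique : (∀ {t} → t ∈ T → HasPartner t) → ∀ {v v′ t} → t ∈ T → Owns v t → Owns v′ t → v ≡ v′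
  owner-unique partner {v} {v′} {t} t∈T owns owns′ with v Fin.≟ v′ | find (partner t∈T)
  ... | yes v≡v′ | _ = v≡v′
  ... | no v≢v′ | r , r∈E , r≢t , cr≡ct =
    contradiction (Joins-parallel G simple (joins-v-v′ r∈E cr≡ct) (joins-v-v′ (T⊆E t∈T) refl)) r≢t
    where
      joins-v-v′ : ∀ {e} → e ∈ E → c e ≡ c t → Joins G e v v′
      joins-v-v′ e∈E ce≡ct =
        Incident⇒Joins G (Owns⇒Incident owns e∈E ce≡ct) (Owns⇒Incident owns′ e∈E ce≡ct) v≢v′

  tight⇒R<T : 2 ≤ length V → suc (length T) ≡ length V → length R < length T
  tight⇒R<T 2≤V tight = decidable-stable (length R <? length T) λ R≮T →
    <⇒≱ (subst (length T <_) tight ≤-refl)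
      (length-≤-of-injective-relation Fin._≟_ Owns V T (Unique.filter⁺ _ (Unique.allFin⁺ n))
        (∃-owned 2≤V tight) (λ _ _ t∈T → owner-unique (partner R≮T) t∈T))
    where
      partner : ¬ length R < length T → ∀ {t} → t ∈ T → HasPartner t
      partner R≮T {t} t∈T = decidable-stable (hasPartner? t) (R≮T ∘ ¬HasPartner⇒R<T t∈T)

theorem9 : ∀ {n m} (G : Graph n m) → IsSimple G →
    (c : Fin m → ℕ) → RainbowCircuitFree G c → AtMostTwice c → Sparse23 G
theorem9 G simple c rcf twice X 2≤|X| = ≤-trans E≤T+R
  (sparsity-arithmetic R≤T (subst (length T <_) |V|≡|X| (T<V 2≤V))
                       (λ tight → tight⇒R<T 2≤V (trans tight (sym |V|≡|X|))))
  where
    open Sparsity G simple c rcf twice X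
    |V|≡|X| : length V ≡ ∣ X ∣
    |V|≡|X| = length-filter-∈-allFin X
    2≤V : 2 ≤ length V
    2≤V = subst (2 ≤_) (sym |V|≡|X|) 2≤|X|
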